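{- For $n\ge3$ let $g_n(x_1,\ldots,x_n)=x_1x_2\vee x_1x_3\vee\cdots\vee x_1x_n\vee x_2x_3\cdots x_n$. Then $g_n$ is a positive threshold function depending on all its variables, $g_n$ is not linear read-once, and its specification number in the class $\mathcal{H}_n$ is $\sigma_{\mathcal{H}_n}(g_n)=2n$.
   Context: $B=\{0,1\}$. $f$ on $B^n$ is positive if $f(\mathbf{x})=1$ and $\mathbf{x}\preceq\mathbf{y}$ (coordinatewise) imply $f(\mathbf{y})=1$. $f$ is a threshold function if there are reals $w_1,\ldots,w_n,t$ with $f(\mathbf{x})=0\iff\sum w_ix_i\le t$ for all $\mathbf{x}\in B^n$. $\mathcal{H}_n$ is the class of threshold functions of $n$ variables. A set $S\subseteq B^n$ specifies $f\in\mathcal{H}_n$ if $f$ is the only function in $\mathcal{H}_n$ agreeing with $f$ on $S$; $\sigma_{\mathcal{H}_n}(f)$ is the minimum size of such a set. A function is linear read-once (lro) if it is constant or representable by a nested formula: literals $x,\overline{x}$ are nested formulas, and if $t$ is a nested formula not containing $x$ or $\overline{x}$ then $x\vee t$, $x\wedge t$, $\overline{x}\vee t$, $\overline{x}\wedge t$ are nested formulas.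
   Formalization: The weights and the threshold of threshold functions, and so of the functions in the class $\mathcal{H}_n$, are rational instead of real. -}

module Defs where

open import Data.Bool using (Bool; true; false; _∧_; _∨_; not; if_then_else_)
open import Data.Nat using (ℕ; zero; suc)
open import Data.Fin using (Fin)
open import Data.Vec using (Vec; []; _∷_; lookup; updateAt; zipWith; foldr)
import Data.Vec as V
open import Data.List using (List; []; _∷_; [_])
open import Data.List.Membership.Propositional using (_∈_; _∉_)
open import Data.Rational using (ℚ; 0ℚ; _+_; _≤_)
open import Data.Product using (Σ; ∃; _×_)
open import Data.Sum using (_⊎_)
open import Function.Bundles using (_⇔_)
open import Relation.Binary.PropositionalEquality using (_≡_; _≢_)

Point : ℕ → Set
Point n = Vec Bool n

BoolFun : ℕ → Set
BoolFun n = Point n → Bool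

_≼_ : ∀ {n} → Point n → Point n → Set
_≼_ {n} x y = (i : Fin n) → lookup x i ≡ true → lookup y i ≡ true

Positive : ∀ {n} → BoolFun n → Set
Positive {n} f = (x y : Point n) → f x ≡ true → x ≼ y → f y ≡ true

wsum : ∀ {n} → Vec ℚ n → Point n → ℚ
wsum w x = foldr _ _+_ 0ℚ (zipWith (λ wi xi → if xi then wi else 0ℚ) w x)

Threshold : ∀ {n} → BoolFun n → Set
Threshold {n} f = Σ (Vec ℚ n) λ w → Σ ℚ λ t →
  (x : Point n) → (f x ≡ false) ⇔ (wsum w x ≤ t)

DependsOn : ∀ {n} → BoolFun n → Fin n → Set
DependsOn {n} f i = Σ (Point n) λ x → f x ≢ f (updateAt x i not)

DependsOnAll : ∀ {n} → BoolFun n → Set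
DependsOnAll {n} f = (i : Fin n) → DependsOn f i

data Nested (n : ℕ) : List (Fin n) → Set where
  lit  : (i : Fin n) (p : Bool) → Nested n [ i ]
  disj : (i : Fin n) (p : Bool) {vs : List (Fin n)} → Nested n vs → i ∉ vs → Nested n (i ∷ vs)
  conj : (i : Fin n) (p : Bool) {vs : List (Fin n)} → Nested n vs → i ∉ vs → Nested n (i ∷ vs)

litVal : ∀ {n} → Fin n → Bool → Point n → Bool
litVal i true  x = lookup x i
litVal i false x = not (lookup x i)

eval : ∀ {n} {vs : List (Fin n)} → Nested n vs → Point n → Bool
eval (lit i p) x = litVal i p x
eval (disj i p t _) x = litVal i p x ∨ eval t x
eval (conj i p t _) x = litVal i p x ∧ eval t x

Constant : ∀ {n} → BoolFun n → Set
Constant {n} f = Σ Bool λ b → (x : Point n) → f x ≡ b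

LRO : ∀ {n} → BoolFun n → Set
LRO {n} f = Constant f ⊎
  (Σ (List (Fin n)) λ vs → Σ (Nested n vs) λ φ → (x : Point n) → eval φ x ≡ f x)

Specifies : ∀ {n} → List (Point n) → BoolFun n → Set
Specifies {n} S f = Threshold f ×
  ((g : BoolFun n) → Threshold g → ((x : Point n) → x ∈ S → g x ≡ f x) →
     (x : Point n) → g x ≡ f x)

SpecNumber : ∀ {n} → BoolFun n → ℕ → Set
SpecNumber {n} f k =
  (Σ (List (Point n)) λ S → Data.List.length S ≡ k × Specifies S f) ×
  ((S : List (Point n)) → Specifies S f → k Data.Nat.≤ Data.List.length S)

anyV : ∀ {m} → Vec Bool m → Bool
anyV = foldr _ _∨_ false

allV : ∀ {m} → Vec Bool m → Bool
allV = foldr _ _∧_ true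

gfun : ∀ {n} → BoolFun n
gfun [] = false
gfun (x₁ ∷ rest) = (x₁ ∧ anyV rest) ∨ allV rest

-- For x = (x₁, y) we have g_n(1, y) = ⋁ y and g_n(0, y) = ⋀ y.  Hence g_n is cut out by the
-- weights (n−2; 1, …, 1) with threshold n−2, which gives positivity and the threshold property.
-- The 2n boundary points (1, 0…0), (1, e_j), (0, 1…1) and (0, 1…0_j…1) are essential: flipping
-- g_n at any one of them gives another threshold function, so every specifying set contains all
-- of them.  Conversely, a threshold function agreeing with g_n on them has nonnegative weights on
-- x₂, …, xₙ (compare (1, 0…0) with (1, e_j)), so on each fibre x₁ = b it is monotone and is
-- pinned down by the boundary points above and below.  Finally, the head literal of a nested
-- formula implies the formula or is implied by it, whereas no literal implies g_n or is implied
-- by it.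

module Submission where

open import Defs
open import Data.Nat using (ℕ; _≤_; _*_)
open import Data.Product using (_×_)
open import Relation.Nullary using (¬_)

open import Data.Bool using (Bool; true; false; not; _∨_; if_then_else_)
import Data.Bool as Bool
open import Data.Bool.Properties using (not-¬; ¬-not; ∨-identityʳ; ∧-conicalˡ)
open import Data.Empty using (⊥-elim)
open import Data.Fin using (Fin; zero; suc; remQuot; combine)
import Data.Fin.Properties as Fin
open import Data.List using (List; length; tabulate)
import Data.List as List
import Data.List.Properties as List
open import Data.List.Membership.Propositional using (_∈_)
open import Data.List.Membership.Propositional.Properties using (∈-tabulate⁺)
import Data.List.Membership.DecPropositional as DecMembership
open import Data.List.Relation.Unary.Any.Properties using (lookup-index)
open import Data.Nat using (zero; suc; _+_; _<_; _<?_; _≤?_; z≤n; s≤s)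
open import Data.Nat.Properties
  using (≤-reflexive; ≤-trans; <-≤-trans; <⇒≱; ≮⇒≥; ≰⇒>; n≤1+n; m≤n+m; +-monoʳ-≤;
         +-comm; +-assoc; +-identityʳ; +-suc; suc-injective)
open import Data.Product using (∃-syntax; ∃₂; _,_; uncurry)
open import Data.Rational using (ℚ; 0ℚ; 1ℚ)
import Data.Rational as ℚ
import Data.Rational.Properties as ℚ
open import Data.Sum using (_⊎_; inj₁; inj₂)
open import Data.Vec using (Vec; []; _∷_; lookup; replicate; map; sum; updateAt)
import Data.Vec.Properties as Vec
open import Function using (_∘_; id)
open import Function.Bundles using (_⇔_; mk⇔; Equivalence)
open import Function.Definitions using (Injective)
open import Relation.Binary.PropositionalEquality
  using (_≡_; _≢_; refl; sym; trans; cong; subst; _≗_; module ≡-Reasoning)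
open import Relation.Nullary using (Dec; yes; no; does)
open import Relation.Nullary.Decidable using (dec-true; dec-false)

private variable
  k m n : ℕ

true≢false : true ≢ false
true≢false ()

does-true⇒ : {P : Set} (P? : Dec P) → does P? ≡ true → P
does-true⇒ (yes p) _ = p

does-false⇒ : {P : Set} (P? : Dec P) → does P? ≡ false → ¬ P
does-false⇒ (no ¬p) _ = ¬p

≡-does : {P : Set} (P? : Dec P) {b : Bool} → (b ≡ true → P) → (b ≡ false → ¬ P) → b ≡ does P?
≡-does P? {true}  true⇒P  _        = sym (dec-true P? (true⇒P refl))
≡-does P? {false} _       false⇒¬P = sym (dec-false P? (false⇒¬P refl))

zeros : ∀ m → Point m
zeros m = replicate m false

ones : ∀ m → Point m
ones m = replicate m true

unit : Fin m → Point m
unit zero    = true ∷ zeros _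
unit (suc i) = false ∷ unit i

counit : Fin m → Point m
counit zero    = false ∷ ones _
counit (suc i) = true ∷ counit i

≼-refl : (x : Point n) → x ≼ x
≼-refl _ _ = id

∷-≼ : ∀ {a b} {xs ys : Point n} → (a ≡ true → b ≡ true) → xs ≼ ys → (a ∷ xs) ≼ (b ∷ ys)
∷-≼ a≤b _     zero    = a≤b
∷-≼ _   xs≼ys (suc i) = xs≼ys i

≼-tail : ∀ {a b} {xs ys : Point n} → (a ∷ xs) ≼ (b ∷ ys) → xs ≼ ys
≼-tail le i = le (suc i)

zeros-≼ : (ys : Point m) → zeros m ≼ ys
zeros-≼ _ i eq = ⊥-elim (true≢false (trans (sym eq) (Vec.lookup-replicate i false)))

≼-ones : (xs : Point m) → xs ≼ ones m
≼-ones _ i _ = Vec.lookup-replicate i true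

lookup-unit : (i : Fin m) → lookup (unit i) i ≡ true
lookup-unit zero    = refl
lookup-unit (suc i) = lookup-unit i

lookup-counit : (i : Fin m) → lookup (counit i) i ≡ false
lookup-counit zero    = refl
lookup-counit (suc i) = lookup-counit i

updateAt-zeros : (i : Fin m) → updateAt (zeros m) i not ≡ unit i
updateAt-zeros zero    = refl
updateAt-zeros (suc i) = cong (false ∷_) (updateAt-zeros i)

zeros≢unit : (i : Fin m) → zeros m ≢ unit i
zeros≢unit (suc i) eq = zeros≢unit i (Vec.∷-injectiveʳ eq)

ones≢counit : (i : Fin m) → ones m ≢ counit i
ones≢counit (suc i) eq = ones≢counit i (Vec.∷-injectiveʳ eq)

unit-injective : Injective _≡_ _≡_ (unit {m})
unit-injective {x = zero}  {zero}  _  = refl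
unit-injective {x = suc i} {suc j} eq = cong suc (unit-injective (Vec.∷-injectiveʳ eq))

counit-injective : Injective _≡_ _≡_ (counit {m})
counit-injective {x = zero}  {zero}  _  = refl
counit-injective {x = suc i} {suc j} eq = cong suc (counit-injective (Vec.∷-injectiveʳ eq))

anyV-zeros : ∀ m → anyV (zeros m) ≡ false
anyV-zeros zero    = refl
anyV-zeros (suc m) = anyV-zeros m

allV-ones : ∀ m → allV (ones m) ≡ true
allV-ones zero    = refl
allV-ones (suc m) = allV-ones m

anyV-unit : (i : Fin m) → anyV (unit i) ≡ true
anyV-unit zero    = refl
anyV-unit (suc i) = anyV-unit i

allV-counit : (i : Fin m) → allV (counit i) ≡ false
allV-counit zero    = refl
allV-counit (suc i) = allV-counit i

allV-unit : (i : Fin (2 + k)) → allV (unit i) ≡ false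
allV-unit zero    = refl
allV-unit (suc i) = refl

anyV-counit : (i : Fin (2 + k)) → anyV (counit i) ≡ true
anyV-counit zero    = refl
anyV-counit (suc i) = refl

anyV≡false⇒zeros : (ys : Point m) → anyV ys ≡ false → ys ≡ zeros m
anyV≡false⇒zeros []           _  = refl
anyV≡false⇒zeros (false ∷ ys) eq = cong (false ∷_) (anyV≡false⇒zeros ys eq)

allV≡true⇒ones : (ys : Point m) → allV ys ≡ true → ys ≡ ones m
allV≡true⇒ones []          _  = refl
allV≡true⇒ones (true ∷ ys) eq = cong (true ∷_) (allV≡true⇒ones ys eq)

anyV≡true⇒unit≼ : (ys : Point m) → anyV ys ≡ true → ∃[ i ] unit i ≼ ys
anyV≡true⇒unit≼ (true ∷ ys)  _  = zero , ∷-≼ id (zeros-≼ ys)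
anyV≡true⇒unit≼ (false ∷ ys) eq = let i , le = anyV≡true⇒unit≼ ys eq in suc i , ∷-≼ id le

allV≡false⇒≼counit : (ys : Point m) → allV ys ≡ false → ∃[ i ] ys ≼ counit i
allV≡false⇒≼counit (false ∷ ys) _  = zero , ∷-≼ id (≼-ones ys)
allV≡false⇒≼counit (true ∷ ys)  eq = let i , le = allV≡false⇒≼counit ys eq in suc i , ∷-≼ id le

anyV≡true⇒other-unit≼ : (ys : Point m) (j : Fin m) → anyV ys ≡ true → ys ≢ unit j →
                        ∃[ i ] i ≢ j × unit i ≼ ys
anyV≡true⇒other-unit≼ (_ ∷ ys) zero _ _ with anyV ys in eq
... | true  = let i , le = anyV≡true⇒unit≼ ys eq in suc i , (λ ()) , ∷-≼ (λ ()) le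
anyV≡true⇒other-unit≼ (true  ∷ ys) zero _  ys≢ | false =
  ⊥-elim (ys≢ (cong (true ∷_) (anyV≡false⇒zeros ys eq)))
anyV≡true⇒other-unit≼ (false ∷ ys) zero () _   | false
anyV≡true⇒other-unit≼ (true  ∷ ys) (suc j) _    _   = zero , (λ ()) , ∷-≼ id (zeros-≼ ys)
anyV≡true⇒other-unit≼ (false ∷ ys) (suc j) any≡ ys≢ =
  let i , i≢j , le = anyV≡true⇒other-unit≼ ys j any≡ (ys≢ ∘ cong (false ∷_))
  in  suc i , i≢j ∘ Fin.suc-injective , ∷-≼ id le

allV≡false⇒≼other-counit : (ys : Point m) (j : Fin m) → allV ys ≡ false → ys ≢ counit j →
                           ∃[ i ] i ≢ j × ys ≼ counit i
allV≡false⇒≼other-counit (_ ∷ ys) zero _ _ with allV ys in eq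
... | false = let i , le = allV≡false⇒≼counit ys eq in suc i , (λ ()) , ∷-≼ (λ _ → refl) le
allV≡false⇒≼other-counit (false ∷ ys) zero _  ys≢ | true =
  ⊥-elim (ys≢ (cong (false ∷_) (allV≡true⇒ones ys eq)))
allV≡false⇒≼other-counit (true  ∷ ys) zero () _   | true
allV≡false⇒≼other-counit (false ∷ ys) (suc j) _    _   = zero , (λ ()) , ∷-≼ id (≼-ones ys)
allV≡false⇒≼other-counit (true  ∷ ys) (suc j) all≡ ys≢ =
  let i , i≢j , le = allV≡false⇒≼other-counit ys j all≡ (ys≢ ∘ cong (true ∷_))
  in  suc i , i≢j ∘ Fin.suc-injective , ∷-≼ id le

-- Threshold functions with natural weights

nsum : Vec ℕ n → Point n → ℕ
nsum []       []       = 0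
nsum (w ∷ ws) (b ∷ ys) = (if b then w else 0) + nsum ws ys

thresholdℕ : Vec ℕ n → ℕ → BoolFun n
thresholdℕ ws t y = does (t <? nsum ws y)

nsum-mono : (ws : Vec ℕ n) {xs ys : Point n} → xs ≼ ys → nsum ws xs ≤ nsum ws ys
nsum-mono []       {[]}         {[]}         _  = z≤n
nsum-mono (w ∷ ws) {true ∷ xs}  {true ∷ ys}  le = +-monoʳ-≤ w (nsum-mono ws (≼-tail le))
nsum-mono (w ∷ ws) {true ∷ xs}  {false ∷ ys} le = ⊥-elim (true≢false (sym (le zero refl)))
nsum-mono (w ∷ ws) {false ∷ xs} {b ∷ ys}     le = ≤-trans (nsum-mono ws (≼-tail le)) (m≤n+m _ _)

nsum-zeros : (ws : Vec ℕ m) → nsum ws (zeros m) ≡ 0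
nsum-zeros []       = refl
nsum-zeros (w ∷ ws) = nsum-zeros ws

nsum-ones : (ws : Vec ℕ m) → nsum ws (ones m) ≡ sum ws
nsum-ones []       = refl
nsum-ones (w ∷ ws) = cong (w +_) (nsum-ones ws)

nsum-unit : (ws : Vec ℕ m) (i : Fin m) → nsum ws (unit i) ≡ lookup ws i
nsum-unit (w ∷ ws) zero    = trans (cong (w +_) (nsum-zeros ws)) (+-identityʳ w)
nsum-unit (w ∷ ws) (suc i) = nsum-unit ws i

nsum-counit : (ws : Vec ℕ m) (i : Fin m) → lookup ws i + nsum ws (counit i) ≡ sum ws
nsum-counit (w ∷ ws) zero    = cong (w +_) (nsum-ones ws)
nsum-counit (w ∷ ws) (suc i) = begin
  lookup ws i + (w + nsum ws (counit i)) ≡⟨ sym (+-assoc (lookup ws i) w _) ⟩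
  lookup ws i + w + nsum ws (counit i)   ≡⟨ cong (_+ nsum ws (counit i)) (+-comm (lookup ws i) w) ⟩
  w + lookup ws i + nsum ws (counit i)   ≡⟨ +-assoc w (lookup ws i) _ ⟩
  w + (lookup ws i + nsum ws (counit i)) ≡⟨ cong (w +_) (nsum-counit ws i) ⟩
  w + sum ws                             ∎
  where open ≡-Reasoning

thresholdℕ-by-witnesses : {h : BoolFun n} (ws : Vec ℕ n) (t : ℕ) →
  (∀ y → h y ≡ true  → ∃[ u ] u ≼ y × t < nsum ws u) →
  (∀ y → h y ≡ false → ∃[ v ] y ≼ v × nsum ws v ≤ t) →
  h ≗ thresholdℕ ws t
thresholdℕ-by-witnesses ws t above below y = ≡-does (t <? nsum ws y)
  (λ hy → let u , u≼y , t<u = above y hy in <-≤-trans t<u (nsum-mono ws u≼y))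
  (λ hy t<y → let v , y≼v , v≤t = below y hy in <⇒≱ t<y (≤-trans (nsum-mono ws y≼v) v≤t))

<⇒≱ℚ : ∀ {p q} → p ℚ.< q → ¬ (q ℚ.≤ p)
<⇒≱ℚ p<q q≤p = ℚ.<-irrefl refl (ℚ.<-≤-trans p<q q≤p)

toℚ : ℕ → ℚ
toℚ zero    = 0ℚ
toℚ (suc a) = 1ℚ ℚ.+ toℚ a

toℚ-+ : ∀ a b → toℚ (a + b) ≡ toℚ a ℚ.+ toℚ b
toℚ-+ zero    b = sym (ℚ.+-identityˡ (toℚ b))
toℚ-+ (suc a) b = trans (cong (1ℚ ℚ.+_) (toℚ-+ a b)) (sym (ℚ.+-assoc 1ℚ (toℚ a) (toℚ b)))

toℚ-<-suc : ∀ a → toℚ a ℚ.< toℚ (suc a)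
toℚ-<-suc a = subst (ℚ._< toℚ (suc a)) (ℚ.+-identityˡ (toℚ a))
                (ℚ.+-mono-<-≤ (ℚ.positive⁻¹ 1ℚ) (ℚ.≤-refl {toℚ a}))

toℚ-mono-≤ : ∀ {a b} → a ≤ b → toℚ a ℚ.≤ toℚ b
toℚ-mono-≤ {b = zero}  z≤n = ℚ.≤-refl
toℚ-mono-≤ {b = suc b} z≤n = ℚ.≤-trans (toℚ-mono-≤ {b = b} z≤n) (ℚ.<⇒≤ (toℚ-<-suc b))
toℚ-mono-≤ (s≤s a≤b) = ℚ.+-monoʳ-≤ 1ℚ (toℚ-mono-≤ a≤b)

toℚ-cancel-≤ : ∀ {a b} → toℚ a ℚ.≤ toℚ b → a ≤ b
toℚ-cancel-≤ {a} {b} le with a ≤? b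
... | yes a≤b = a≤b
... | no  a≰b = ⊥-elim (<⇒≱ℚ (ℚ.<-≤-trans (toℚ-<-suc b) (toℚ-mono-≤ (≰⇒> a≰b))) le)

wsum-toℚ : (ws : Vec ℕ n) (y : Point n) → wsum (map toℚ ws) y ≡ toℚ (nsum ws y)
wsum-toℚ []       []           = refl
wsum-toℚ (w ∷ ws) (true ∷ ys)  = trans (cong (toℚ w ℚ.+_) (wsum-toℚ ws ys)) (sym (toℚ-+ w _))
wsum-toℚ (w ∷ ws) (false ∷ ys) = trans (ℚ.+-identityˡ _) (wsum-toℚ ws ys)

≗thresholdℕ⇒threshold : {f : BoolFun n} (ws : Vec ℕ n) (t : ℕ) → f ≗ thresholdℕ ws t → Threshold f
≗thresholdℕ⇒threshold {f = f} ws t f≗ = map toℚ ws , toℚ t , λ y →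
  subst (λ q → (f y ≡ false) ⇔ (q ℚ.≤ toℚ t)) (sym (wsum-toℚ ws y)) (false⇔ y)
  where
  false⇔ : ∀ y → (f y ≡ false) ⇔ (toℚ (nsum ws y) ℚ.≤ toℚ t)
  false⇔ y = mk⇔
    (λ fy → toℚ-mono-≤ (≮⇒≥ (does-false⇒ (t <? nsum ws y) (trans (sym (f≗ y)) fy))))
    (λ le → trans (f≗ y) (dec-false (t <? nsum ws y) (λ t<y → <⇒≱ t<y (toℚ-cancel-≤ le))))

≗thresholdℕ⇒positive : {f : BoolFun n} (ws : Vec ℕ n) (t : ℕ) → f ≗ thresholdℕ ws t → Positive f
≗thresholdℕ⇒positive ws t f≗ x y fx x≼y = trans (f≗ y) (dec-true (t <? nsum ws y)
  (<-≤-trans (does-true⇒ (t <? nsum ws x) (trans (sym (f≗ x)) fx)) (nsum-mono ws x≼y)))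

threshold-by-witnesses : {h : BoolFun n} (ws : Vec ℕ n) (t : ℕ) →
  (∀ y → h y ≡ true  → ∃[ u ] u ≼ y × t < nsum ws u) →
  (∀ y → h y ≡ false → ∃[ v ] y ≼ v × nsum ws v ≤ t) →
  Threshold h
threshold-by-witnesses ws t above below =
  ≗thresholdℕ⇒threshold ws t (thresholdℕ-by-witnesses ws t above below)

threshold-true⇔ : {g : BoolFun n} {w : Vec ℚ n} {t : ℚ} →
  ((x : Point n) → (g x ≡ false) ⇔ (wsum w x ℚ.≤ t)) →
  (x : Point n) → (g x ≡ true) ⇔ (t ℚ.< wsum w x)
threshold-true⇔ separates x = mk⇔
  (λ gx → ℚ.≰⇒> (λ le → true≢false (trans (sym gx) (Equivalence.from (separates x) le))))
  (λ t< → ¬-not (λ gx → <⇒≱ℚ t< (Equivalence.to (separates x) gx)))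

wsum-zeros : (ws : Vec ℚ m) → wsum ws (zeros m) ≡ 0ℚ
wsum-zeros []       = refl
wsum-zeros (w ∷ ws) = trans (ℚ.+-identityˡ _) (wsum-zeros ws)

wsum-unit : (ws : Vec ℚ m) (i : Fin m) → wsum ws (unit i) ≡ lookup ws i
wsum-unit (w ∷ ws) zero    = trans (cong (w ℚ.+_) (wsum-zeros ws)) (ℚ.+-identityʳ w)
wsum-unit (w ∷ ws) (suc i) = trans (ℚ.+-identityˡ _) (wsum-unit ws i)

wsum-mono : (ws : Vec ℚ m) → (∀ i → 0ℚ ℚ.≤ lookup ws i) →
            {xs ys : Point m} → xs ≼ ys → wsum ws xs ℚ.≤ wsum ws ys
wsum-mono []       _  {[]}         {[]}         _  = ℚ.≤-refl
wsum-mono (w ∷ ws) nn {true ∷ xs}  {true ∷ ys}  le = ℚ.+-monoʳ-≤ w (wsum-mono ws (nn ∘ suc) (≼-tail le))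
wsum-mono (w ∷ ws) nn {true ∷ xs}  {false ∷ ys} le = ⊥-elim (true≢false (sym (le zero refl)))
wsum-mono (w ∷ ws) nn {false ∷ xs} {true ∷ ys}  le =
  ℚ.+-mono-≤ (nn zero) (wsum-mono ws (nn ∘ suc) (≼-tail le))
wsum-mono (w ∷ ws) nn {false ∷ xs} {false ∷ ys} le = ℚ.+-monoʳ-≤ 0ℚ (wsum-mono ws (nn ∘ suc) (≼-tail le))

-- Specifying sets

_≟ₚ_ : (x y : Point n) → Dec (x ≡ y)
_≟ₚ_ = Vec.≡-dec Bool._≟_

flipAt : BoolFun n → Point n → BoolFun n
flipAt f x y = if does (y ≟ₚ x) then not (f y) else f y

flipAt-self : (f : BoolFun n) (x : Point n) → flipAt f x x ≡ not (f x)
flipAt-self f x with x ≟ₚ x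
... | yes _   = refl
... | no  x≢x = ⊥-elim (x≢x refl)

flipAt-off : {f : BoolFun n} {x y : Point n} → y ≢ x → flipAt f x y ≡ f y
flipAt-off {x = x} {y} y≢x with y ≟ₚ x
... | yes y≡x = ⊥-elim (y≢x y≡x)
... | no  _   = refl

flipAt-cases : (f : BoolFun n) (x y : Point n) {b c : Bool} → f x ≡ c → flipAt f x y ≡ b →
               (y ≡ x × b ≡ not c) ⊎ (y ≢ x × f y ≡ b)
flipAt-cases f x y fx≡c eq with y ≟ₚ x
... | yes refl = inj₁ (refl , trans (sym eq) (cong not fx≡c))
... | no  y≢x  = inj₂ (y≢x , eq)

essential∈specifying : {S : List (Point n)} {f : BoolFun n} {x : Point n} →
                       Specifies S f → Threshold (flipAt f x) → x ∈ S
essential∈specifying {S = S} {f} {x} (_ , determined) thr with DecMembership._∈?_ _≟ₚ_ x S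
... | yes x∈S = x∈S
... | no  x∉S =
  ⊥-elim (not-¬ refl (sym (trans (sym (flipAt-self f x)) (determined (flipAt f x) thr agree x))))
  where
  agree : ∀ y → y ∈ S → flipAt f x y ≡ f y
  agree y y∈S = flipAt-off {f = f} {x} {y} λ { refl → x∉S y∈S }

injective-∈⇒≤-length : {A : Set} {K : ℕ} {S : List A} {p : Fin K → A} →
                       Injective _≡_ _≡_ p → (∀ i → p i ∈ S) → K ≤ length S
injective-∈⇒≤-length {S = S} p-injective mem = Fin.injective⇒≤ λ {i} {j} eq →
  p-injective (trans (lookup-index (mem i))
                     (trans (cong (List.lookup S) eq) (sym (lookup-index (mem j)))))

-- Boundary points of g_n

raised : Fin (suc m) → Point (suc m)
raised zero    = true ∷ zeros _
raised (suc i) = true ∷ unit i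

lowered : Fin (suc m) → Point (suc m)
lowered zero    = false ∷ ones _
lowered (suc i) = false ∷ counit i

raised-injective : Injective _≡_ _≡_ (raised {m})
raised-injective {x = zero}  {zero}  _  = refl
raised-injective {x = zero}  {suc j} eq = ⊥-elim (zeros≢unit j (Vec.∷-injectiveʳ eq))
raised-injective {x = suc i} {zero}  eq = ⊥-elim (zeros≢unit i (sym (Vec.∷-injectiveʳ eq)))
raised-injective {x = suc i} {suc j} eq = cong suc (unit-injective (Vec.∷-injectiveʳ eq))

lowered-injective : Injective _≡_ _≡_ (lowered {m})
lowered-injective {x = zero}  {zero}  _  = refl
lowered-injective {x = zero}  {suc j} eq = ⊥-elim (ones≢counit j (Vec.∷-injectiveʳ eq))
lowered-injective {x = suc i} {zero}  eq = ⊥-elim (ones≢counit i (sym (Vec.∷-injectiveʳ eq)))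
lowered-injective {x = suc i} {suc j} eq = cong suc (counit-injective (Vec.∷-injectiveʳ eq))

raised≢lowered : (i j : Fin (suc m)) → raised i ≢ lowered j
raised≢lowered zero    zero    ()
raised≢lowered zero    (suc _) ()
raised≢lowered (suc _) zero    ()
raised≢lowered (suc _) (suc _) ()

-- Indexed by Fin 2 × Fin n so that remQuot lists the boundary points with length exactly 2 * n.
boundary : Fin 2 × Fin (suc m) → Point (suc m)
boundary (zero  , i) = raised i
boundary (suc _ , i) = lowered i

boundary-injective : Injective _≡_ _≡_ (boundary {m})
boundary-injective {x = zero , i}     {zero , j}     eq = cong (zero ,_) (raised-injective eq)
boundary-injective {x = zero , i}     {suc _ , j}    eq = ⊥-elim (raised≢lowered i j eq)
boundary-injective {x = suc _ , i}    {zero , j}     eq = ⊥-elim (raised≢lowered j i (sym eq))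
boundary-injective {x = suc zero , i} {suc zero , j} eq = cong (suc zero ,_) (lowered-injective eq)

boundaryPoints : ∀ m → List (Point (suc m))
boundaryPoints m = tabulate (boundary ∘ remQuot (suc m))

boundary∈boundaryPoints : (p : Fin 2 × Fin (suc m)) → boundary p ∈ boundaryPoints m
boundary∈boundaryPoints (i , j) =
  subst (_∈ boundaryPoints _) (cong boundary (Fin.remQuot-combine i j))
        (∈-tabulate⁺ {f = boundary ∘ remQuot (suc _)} (combine i j))

remQuot-injective : Injective _≡_ _≡_ (remQuot {2} (suc m))
remQuot-injective {m} {i} {j} eq =
  trans (sym (Fin.combine-remQuot (suc m) i))
        (trans (cong (uncurry combine) eq) (Fin.combine-remQuot (suc m) j))

gfun-true∷ : (ys : Point (suc m)) → gfun (true ∷ ys) ≡ anyV ys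
gfun-true∷ (true ∷ ys)  = refl
gfun-true∷ (false ∷ ys) = ∨-identityʳ (anyV ys)

gfun-raised-zero : ∀ m → gfun (raised {suc m} zero) ≡ false
gfun-raised-zero m = trans (gfun-true∷ (zeros (suc m))) (anyV-zeros (suc m))

gfun-raised-suc : (i : Fin (suc m)) → gfun (raised (suc i)) ≡ true
gfun-raised-suc i = trans (gfun-true∷ (unit i)) (anyV-unit i)

gfun-lowered-zero : ∀ m → gfun (lowered {m} zero) ≡ true
gfun-lowered-zero m = allV-ones m

gfun-lowered-suc : (i : Fin m) → gfun (lowered (suc i)) ≡ false
gfun-lowered-suc = allV-counit

gfun≡true⇒above-boundary : (y : Point (2 + m)) → gfun y ≡ true →
                           (∃[ i ] raised (suc i) ≼ y) ⊎ y ≡ lowered zero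
gfun≡true⇒above-boundary (true ∷ ys) g≡ =
  let i , le = anyV≡true⇒unit≼ ys (trans (sym (gfun-true∷ ys)) g≡) in inj₁ (i , ∷-≼ id le)
gfun≡true⇒above-boundary (false ∷ ys) g≡ = inj₂ (cong (false ∷_) (allV≡true⇒ones ys g≡))

gfun≡false⇒below-boundary : (y : Point (2 + m)) → gfun y ≡ false →
                            y ≡ raised zero ⊎ (∃[ i ] y ≼ lowered (suc i))
gfun≡false⇒below-boundary (true ∷ ys) g≡ =
  inj₁ (cong (true ∷_) (anyV≡false⇒zeros ys (trans (sym (gfun-true∷ ys)) g≡)))
gfun≡false⇒below-boundary (false ∷ ys) g≡ =
  let i , le = allV≡false⇒≼counit ys g≡ in inj₂ (i , ∷-≼ id le)

gfun≡true⇒above-other-boundary : (y : Point (2 + m)) (j : Fin (suc m)) →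
                                 gfun y ≡ true → y ≢ raised (suc j) →
                                 (∃[ i ] i ≢ j × raised (suc i) ≼ y) ⊎ y ≡ lowered zero
gfun≡true⇒above-other-boundary (true ∷ ys) j g≡ y≢ =
  let i , i≢j , le = anyV≡true⇒other-unit≼ ys j (trans (sym (gfun-true∷ ys)) g≡)
                                           (y≢ ∘ cong (true ∷_))
  in  inj₁ (i , i≢j , ∷-≼ id le)
gfun≡true⇒above-other-boundary (false ∷ ys) j g≡ _ =
  inj₂ (cong (false ∷_) (allV≡true⇒ones ys g≡))

gfun≡false⇒below-other-boundary : (y : Point (2 + m)) (j : Fin (suc m)) →
                                  gfun y ≡ false → y ≢ lowered (suc j) →
                                  y ≡ raised zero ⊎ (∃[ i ] i ≢ j × y ≼ lowered (suc i))
gfun≡false⇒below-other-boundary (true ∷ ys) j g≡ _ =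
  inj₁ (cong (true ∷_) (anyV≡false⇒zeros ys (trans (sym (gfun-true∷ ys)) g≡)))
gfun≡false⇒below-other-boundary (false ∷ ys) j g≡ y≢ =
  let i , i≢j , le = allV≡false⇒≼other-counit ys j g≡ (y≢ ∘ cong (false ∷_))
  in  inj₂ (i , i≢j , ∷-≼ id le)

gfun-depends : DependsOnAll (gfun {3 + k})
gfun-depends zero    = raised (suc zero) , λ ()
gfun-depends {k} (suc j) = raised zero , λ eq → true≢false (begin
  true                                       ≡⟨ gfun-raised-suc j ⟨
  gfun (raised (suc j))                      ≡⟨ cong (λ ys → gfun (true ∷ ys)) (updateAt-zeros j) ⟨
  gfun (updateAt (raised zero) (suc j) not)  ≡⟨ eq ⟨
  gfun (raised {2 + k} zero)                 ≡⟨ gfun-raised-zero (suc k) ⟩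
  false                                      ∎)
  where open ≡-Reasoning

nsum-raised-zero : (w : ℕ) (ws : Vec ℕ m) → nsum (w ∷ ws) (raised zero) ≡ w
nsum-raised-zero w ws = trans (cong (w +_) (nsum-zeros ws)) (+-identityʳ w)

nsum-raised-suc : (w : ℕ) (ws : Vec ℕ m) (i : Fin m) →
                  nsum (w ∷ ws) (raised (suc i)) ≡ lookup ws i + w
nsum-raised-suc w ws i = trans (cong (w +_) (nsum-unit ws i)) (+-comm w _)

sum-replicate-1 : ∀ m → sum (replicate m 1) ≡ m
sum-replicate-1 zero    = refl
sum-replicate-1 (suc m) = cong suc (sum-replicate-1 m)

nsum-ones-raised : (w : ℕ) (i : Fin m) → nsum (w ∷ replicate m 1) (raised (suc i)) ≡ suc w
nsum-ones-raised {m} w i =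
  trans (nsum-raised-suc w (replicate m 1) i) (cong (_+ w) (Vec.lookup-replicate i 1))

nsum-ones-ones : ∀ m → nsum (replicate m 1) (ones m) ≡ m
nsum-ones-ones m = trans (nsum-ones (replicate m 1)) (sum-replicate-1 m)

nsum-ones-counit : (i : Fin (suc m)) → nsum (replicate (suc m) 1) (counit i) ≡ m
nsum-ones-counit {m} i = suc-injective (begin
  suc (nsum ws (counit i))           ≡⟨ cong (_+ nsum ws (counit i)) (Vec.lookup-replicate i 1) ⟨
  lookup ws i + nsum ws (counit i)   ≡⟨ nsum-counit ws i ⟩
  sum ws                             ≡⟨ sum-replicate-1 (suc m) ⟩
  suc m                              ∎)
  where
  ws = replicate (suc m) 1
  open ≡-Reasoning

dip : Fin m → Vec ℕ m
dip zero    = 1 ∷ replicate _ 2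
dip (suc j) = 2 ∷ dip j

lookup-dip-self : (j : Fin m) → lookup (dip j) j ≡ 1
lookup-dip-self zero    = refl
lookup-dip-self (suc j) = lookup-dip-self j

lookup-dip-≢ : {i j : Fin m} → i ≢ j → lookup (dip j) i ≡ 2
lookup-dip-≢ {i = zero}  {zero}  i≢j = ⊥-elim (i≢j refl)
lookup-dip-≢ {i = zero}  {suc j} _   = refl
lookup-dip-≢ {i = suc i} {zero}  _   = Vec.lookup-replicate i 2
lookup-dip-≢ {i = suc i} {suc j} i≢j = lookup-dip-≢ (i≢j ∘ cong suc)

sum-replicate-2 : ∀ m → sum (replicate m 2) ≡ m + m
sum-replicate-2 zero    = refl
sum-replicate-2 (suc m) = trans (cong (2 +_) (sum-replicate-2 m)) (cong suc (sym (+-suc m m)))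

sum-dip : (j : Fin (suc m)) → sum (dip j) ≡ suc (m + m)
sum-dip {m}     zero    = cong suc (sum-replicate-2 m)
sum-dip {suc m} (suc j) =
  trans (cong (2 +_) (sum-dip j)) (cong (λ x → suc (suc x)) (sym (+-suc m m)))

nsum-dip-raised-self : (w : ℕ) (j : Fin m) → nsum (w ∷ dip j) (raised (suc j)) ≡ suc w
nsum-dip-raised-self w j = trans (nsum-raised-suc w (dip j) j) (cong (_+ w) (lookup-dip-self j))

nsum-dip-raised-≢ : (w : ℕ) {i j : Fin m} → i ≢ j → nsum (w ∷ dip j) (raised (suc i)) ≡ suc (suc w)
nsum-dip-raised-≢ w {i} {j} i≢j =
  trans (nsum-raised-suc w (dip j) i) (cong (_+ w) (lookup-dip-≢ i≢j))

nsum-dip-raised-≥ : (w : ℕ) (j i : Fin m) → suc w ≤ nsum (w ∷ dip j) (raised (suc i))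
nsum-dip-raised-≥ w j i with i Fin.≟ j
... | yes refl = ≤-reflexive (sym (nsum-dip-raised-self w i))
... | no  i≢j  = ≤-trans (n≤1+n _) (≤-reflexive (sym (nsum-dip-raised-≢ w i≢j)))

nsum-dip-ones : (j : Fin (suc m)) → nsum (dip j) (ones (suc m)) ≡ suc (m + m)
nsum-dip-ones j = trans (nsum-ones (dip j)) (sum-dip j)

nsum-dip-counit-self : (j : Fin (suc m)) → nsum (dip j) (counit j) ≡ m + m
nsum-dip-counit-self {m} j = suc-injective (begin
  suc (nsum (dip j) (counit j))                ≡⟨ cong (_+ nsum (dip j) (counit j)) (lookup-dip-self j) ⟨
  lookup (dip j) j + nsum (dip j) (counit j)   ≡⟨ nsum-counit (dip j) j ⟩
  sum (dip j)                                  ≡⟨ sum-dip j ⟩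
  suc (m + m)                                  ∎)
  where open ≡-Reasoning

nsum-dip-counit-≢ : {i j : Fin (suc m)} → i ≢ j → suc (nsum (dip j) (counit i)) ≡ m + m
nsum-dip-counit-≢ {m} {i} {j} i≢j = suc-injective (begin
  suc (suc (nsum (dip j) (counit i)))          ≡⟨ cong (_+ nsum (dip j) (counit i)) (lookup-dip-≢ i≢j) ⟨
  lookup (dip j) i + nsum (dip j) (counit i)   ≡⟨ nsum-counit (dip j) i ⟩
  sum (dip j)                                  ≡⟨ sum-dip j ⟩
  suc (m + m)                                  ∎)
  where open ≡-Reasoning

nsum-dip-counit-≤ : (j i : Fin (suc m)) → nsum (dip j) (counit i) ≤ m + m
nsum-dip-counit-≤ j i with i Fin.≟ j
... | yes refl = ≤-reflexive (nsum-dip-counit-self i)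
... | no  i≢j  = ≤-trans (n≤1+n _) (≤-reflexive (nsum-dip-counit-≢ i≢j))

gfun-weights : ∀ k → Vec ℕ (3 + k)
gfun-weights k = suc k ∷ replicate (2 + k) 1

gfun-≗thresholdℕ : gfun {3 + k} ≗ thresholdℕ (gfun-weights k) (suc k)
gfun-≗thresholdℕ {k} = thresholdℕ-by-witnesses (gfun-weights k) (suc k) above below
  where
  ws = gfun-weights k
  above : ∀ y → gfun y ≡ true → ∃[ u ] u ≼ y × suc k < nsum ws u
  above y g≡ with gfun≡true⇒above-boundary y g≡
  ... | inj₁ (i , le) = raised (suc i) , le , ≤-reflexive (sym (nsum-ones-raised (suc k) i))
  ... | inj₂ refl     =
    lowered zero , ≼-refl (lowered zero) , ≤-reflexive (sym (nsum-ones-ones (2 + k)))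
  below : ∀ y → gfun y ≡ false → ∃[ v ] y ≼ v × nsum ws v ≤ suc k
  below y g≡ with gfun≡false⇒below-boundary y g≡
  ... | inj₁ refl     =
    raised zero , ≼-refl (raised zero) , ≤-reflexive (nsum-raised-zero (suc k) (replicate (2 + k) 1))
  ... | inj₂ (i , le) = lowered (suc i) , le , ≤-reflexive (nsum-ones-counit i)

gfun-threshold : Threshold (gfun {3 + k})
gfun-threshold {k} = ≗thresholdℕ⇒threshold (gfun-weights k) (suc k) gfun-≗thresholdℕ

gfun-positive : Positive (gfun {3 + k})
gfun-positive {k} = ≗thresholdℕ⇒positive (gfun-weights k) (suc k) gfun-≗thresholdℕ

-- Under the weights (n−1; 1, …, 1), and also under (2n−5; dip j), g_n fails to be a threshold
-- function by a single tie: one true and one false boundary point, (0, 1…1) and (1, 0…0), resp.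
-- (1, e_j) and (0, 1…0_j…1), have the same weight s, while all other true points are heavier and
-- all other false points are lighter.  Threshold s or s − 1 therefore cuts out the flip at either.

raised-zero-essential : Threshold (flipAt (gfun {3 + k}) (raised zero))
raised-zero-essential {k} = threshold-by-witnesses ws (suc k) above below
  where
  ws : Vec ℕ (3 + k)
  ws = 2 + k ∷ replicate (2 + k) 1
  above : ∀ y → flipAt gfun (raised zero) y ≡ true → ∃[ u ] u ≼ y × suc k < nsum ws u
  above y f≡ with flipAt-cases gfun (raised zero) y (gfun-raised-zero (suc k)) f≡
  ... | inj₁ (refl , _) =
    raised zero , ≼-refl (raised zero) ,
    ≤-reflexive (sym (nsum-raised-zero (2 + k) (replicate (2 + k) 1)))
  ... | inj₂ (_ , g≡) with gfun≡true⇒above-boundary y g≡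
  ...   | inj₁ (i , le) =
    raised (suc i) , le , ≤-trans (n≤1+n _) (≤-reflexive (sym (nsum-ones-raised (2 + k) i)))
  ...   | inj₂ refl     =
    lowered zero , ≼-refl (lowered zero) , ≤-reflexive (sym (nsum-ones-ones (2 + k)))
  below : ∀ y → flipAt gfun (raised zero) y ≡ false → ∃[ v ] y ≼ v × nsum ws v ≤ suc k
  below y f≡ with flipAt-cases gfun (raised zero) y (gfun-raised-zero (suc k)) f≡
  ... | inj₁ (refl , ())
  ... | inj₂ (y≢ , g≡) with gfun≡false⇒below-boundary y g≡
  ...   | inj₁ refl     = ⊥-elim (y≢ refl)
  ...   | inj₂ (i , le) = lowered (suc i) , le , ≤-reflexive (nsum-ones-counit i)

lowered-zero-essential : Threshold (flipAt (gfun {3 + k}) (lowered zero))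
lowered-zero-essential {k} = threshold-by-witnesses ws (2 + k) above below
  where
  ws : Vec ℕ (3 + k)
  ws = 2 + k ∷ replicate (2 + k) 1
  above : ∀ y → flipAt gfun (lowered zero) y ≡ true → ∃[ u ] u ≼ y × 2 + k < nsum ws u
  above y f≡ with flipAt-cases gfun (lowered zero) y (gfun-lowered-zero (2 + k)) f≡
  ... | inj₁ (refl , ())
  ... | inj₂ (y≢ , g≡) with gfun≡true⇒above-boundary y g≡
  ...   | inj₁ (i , le) = raised (suc i) , le , ≤-reflexive (sym (nsum-ones-raised (2 + k) i))
  ...   | inj₂ refl     = ⊥-elim (y≢ refl)
  below : ∀ y → flipAt gfun (lowered zero) y ≡ false → ∃[ v ] y ≼ v × nsum ws v ≤ 2 + k
  below y f≡ with flipAt-cases gfun (lowered zero) y (gfun-lowered-zero (2 + k)) f≡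
  ... | inj₁ (refl , _) =
    lowered zero , ≼-refl (lowered zero) , ≤-reflexive (nsum-ones-ones (2 + k))
  ... | inj₂ (_ , g≡) with gfun≡false⇒below-boundary y g≡
  ...   | inj₁ refl     =
    raised zero , ≼-refl (raised zero) , ≤-reflexive (nsum-raised-zero (2 + k) (replicate (2 + k) 1))
  ...   | inj₂ (i , le) =
    lowered (suc i) , le , ≤-trans (≤-reflexive (nsum-ones-counit i)) (n≤1+n _)

raised-suc-essential : (j : Fin (2 + k)) → Threshold (flipAt (gfun {3 + k}) (raised (suc j)))
raised-suc-essential {k} j = threshold-by-witnesses (w ∷ dip j) (suc w) above below
  where
  w : ℕ
  w = k + suc k
  above : ∀ y → flipAt gfun (raised (suc j)) y ≡ true → ∃[ u ] u ≼ y × suc w < nsum (w ∷ dip j) u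
  above y f≡ with flipAt-cases gfun (raised (suc j)) y (gfun-raised-suc j) f≡
  ... | inj₁ (refl , ())
  ... | inj₂ (y≢ , g≡) with gfun≡true⇒above-other-boundary y j g≡ y≢
  ...   | inj₁ (i , i≢j , le) = raised (suc i) , le , ≤-reflexive (sym (nsum-dip-raised-≢ w i≢j))
  ...   | inj₂ refl           =
    lowered zero , ≼-refl (lowered zero) , ≤-reflexive (sym (nsum-dip-ones j))
  below : ∀ y → flipAt gfun (raised (suc j)) y ≡ false → ∃[ v ] y ≼ v × nsum (w ∷ dip j) v ≤ suc w
  below y f≡ with flipAt-cases gfun (raised (suc j)) y (gfun-raised-suc j) f≡
  ... | inj₁ (refl , _) =
    raised (suc j) , ≼-refl (raised (suc j)) , ≤-reflexive (nsum-dip-raised-self w j)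
  ... | inj₂ (_ , g≡) with gfun≡false⇒below-boundary y g≡
  ...   | inj₁ refl     =
    raised zero , ≼-refl (raised zero) , ≤-trans (≤-reflexive (nsum-raised-zero w (dip j))) (n≤1+n w)
  ...   | inj₂ (i , le) = lowered (suc i) , le , nsum-dip-counit-≤ j i

lowered-suc-essential : (j : Fin (2 + k)) → Threshold (flipAt (gfun {3 + k}) (lowered (suc j)))
lowered-suc-essential {k} j = threshold-by-witnesses (w ∷ dip j) w above below
  where
  w : ℕ
  w = k + suc k
  above : ∀ y → flipAt gfun (lowered (suc j)) y ≡ true → ∃[ u ] u ≼ y × w < nsum (w ∷ dip j) u
  above y f≡ with flipAt-cases gfun (lowered (suc j)) y (gfun-lowered-suc j) f≡
  ... | inj₁ (refl , _) =
    lowered (suc j) , ≼-refl (lowered (suc j)) , ≤-reflexive (sym (nsum-dip-counit-self j))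
  ... | inj₂ (_ , g≡) with gfun≡true⇒above-boundary y g≡
  ...   | inj₁ (i , le) = raised (suc i) , le , nsum-dip-raised-≥ w j i
  ...   | inj₂ refl     =
    lowered zero , ≼-refl (lowered zero) , ≤-trans (n≤1+n _) (≤-reflexive (sym (nsum-dip-ones j)))
  below : ∀ y → flipAt gfun (lowered (suc j)) y ≡ false → ∃[ v ] y ≼ v × nsum (w ∷ dip j) v ≤ w
  below y f≡ with flipAt-cases gfun (lowered (suc j)) y (gfun-lowered-suc j) f≡
  ... | inj₁ (refl , ())
  ... | inj₂ (y≢ , g≡) with gfun≡false⇒below-other-boundary y j g≡ y≢
  ...   | inj₁ refl           =
    raised zero , ≼-refl (raised zero) , ≤-reflexive (nsum-raised-zero w (dip j))
  ...   | inj₂ (i , i≢j , le) =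
    lowered (suc i) , le , ≤-reflexive (suc-injective (nsum-dip-counit-≢ i≢j))

boundary-essential : (p : Fin 2 × Fin (3 + k)) → Threshold (flipAt gfun (boundary p))
boundary-essential (zero  , zero)  = raised-zero-essential
boundary-essential (zero  , suc j) = raised-suc-essential j
boundary-essential (suc _ , zero)  = lowered-zero-essential
boundary-essential (suc _ , suc j) = lowered-suc-essential j

tail-weights-nonneg : {g : BoolFun (suc m)} (w₁ : ℚ) (ws : Vec ℚ m) (t : ℚ) →
  ((x : Point (suc m)) → (g x ≡ false) ⇔ (wsum (w₁ ∷ ws) x ℚ.≤ t)) →
  g (raised zero) ≡ false → (∀ i → g (raised (suc i)) ≡ true) →
  ∀ i → 0ℚ ℚ.≤ lookup ws i
tail-weights-nonneg w₁ ws t separates g₀≡false gᵢ≡true i with ℚ.≤-total 0ℚ (lookup ws i)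
... | inj₁ 0≤wᵢ = 0≤wᵢ
... | inj₂ wᵢ≤0 = ⊥-elim (<⇒≱ℚ t<w₁+wᵢ (ℚ.≤-trans (ℚ.+-monoʳ-≤ w₁ wᵢ≤0) w₁+0≤t))
  where
  t<w₁+wᵢ : t ℚ.< w₁ ℚ.+ lookup ws i
  t<w₁+wᵢ = subst (t ℚ.<_) (cong (w₁ ℚ.+_) (wsum-unit ws i))
              (Equivalence.to (threshold-true⇔ separates (raised (suc i))) (gᵢ≡true i))
  w₁+0≤t : w₁ ℚ.+ 0ℚ ℚ.≤ t
  w₁+0≤t = subst (ℚ._≤ t) (cong (w₁ ℚ.+_) (wsum-zeros ws))
             (Equivalence.to (separates (raised zero)) g₀≡false)

boundary-determines-gfun : (g : BoolFun (3 + k)) → Threshold g →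
                           (∀ p → g (boundary p) ≡ gfun (boundary p)) → g ≗ gfun
boundary-determines-gfun {k} g (w₁ ∷ ws , t , separates) agree = determined
  where
  raised-zero-false : g (raised zero) ≡ false
  raised-zero-false = trans (agree (zero , zero)) (gfun-raised-zero (suc k))
  raised-suc-true : ∀ i → g (raised (suc i)) ≡ true
  raised-suc-true i = trans (agree (zero , suc i)) (gfun-raised-suc i)
  lowered-zero-true : g (lowered zero) ≡ true
  lowered-zero-true = trans (agree (suc zero , zero)) (gfun-lowered-zero (2 + k))
  lowered-suc-false : ∀ i → g (lowered (suc i)) ≡ false
  lowered-suc-false i = trans (agree (suc zero , suc i)) (gfun-lowered-suc i)

  -- The weight w₁ of x₁ may be negative, so monotonicity is only available within a fibre x₁ = b.
  fibre-mono : ∀ b {xs ys} → xs ≼ ys → wsum (w₁ ∷ ws) (b ∷ xs) ℚ.≤ wsum (w₁ ∷ ws) (b ∷ ys)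
  fibre-mono b le = ℚ.+-monoʳ-≤ (if b then w₁ else 0ℚ)
    (wsum-mono ws (tail-weights-nonneg w₁ ws t separates raised-zero-false raised-suc-true) le)

  fibre-true : ∀ ys → g (true ∷ ys) ≡ anyV ys
  fibre-true ys with anyV ys in any≡
  ... | true  = let i , le = anyV≡true⇒unit≼ ys any≡ in
    Equivalence.from (threshold-true⇔ separates (true ∷ ys))
      (ℚ.<-≤-trans (Equivalence.to (threshold-true⇔ separates (raised (suc i))) (raised-suc-true i))
                   (fibre-mono true le))
  ... | false rewrite anyV≡false⇒zeros ys any≡ = raised-zero-false

  fibre-false : ∀ ys → g (false ∷ ys) ≡ allV ys
  fibre-false ys with allV ys in all≡
  ... | true rewrite allV≡true⇒ones ys all≡ = lowered-zero-true
  ... | false = let i , le = allV≡false⇒≼counit ys all≡ in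
    Equivalence.from (separates (false ∷ ys))
      (ℚ.≤-trans (fibre-mono false le)
                 (Equivalence.to (separates (lowered (suc i))) (lowered-suc-false i)))

  determined : g ≗ gfun
  determined (true ∷ ys)  = trans (fibre-true ys) (sym (gfun-true∷ ys))
  determined (false ∷ ys) = fibre-false ys

boundaryPoints-specify : Specifies (boundaryPoints (2 + k)) gfun
boundaryPoints-specify =
  gfun-threshold ,
  λ g thr agree →
    boundary-determines-gfun g thr (λ p → agree (boundary p) (boundary∈boundaryPoints p))

specifying-length : (S : List (Point (3 + k))) → Specifies S gfun → 2 * (3 + k) ≤ length S
specifying-length {k} S spec = injective-∈⇒≤-length (remQuot-injective ∘ boundary-injective)
  (λ i → essential∈specifying spec (boundary-essential (remQuot (3 + k) i)))

gfun-specNumber : SpecNumber (gfun {3 + k}) (2 * (3 + k))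
gfun-specNumber {k} =
  (boundaryPoints (2 + k) , List.length-tabulate (boundary ∘ remQuot (3 + k)) ,
   boundaryPoints-specify) ,
  specifying-length

-- Linear read-once formulas

nested-head-literal : {vs : List (Fin n)} (φ : Nested n vs) → ∃₂ λ i p →
  (∀ x → litVal i p x ≡ true → eval φ x ≡ true) ⊎ (∀ x → eval φ x ≡ true → litVal i p x ≡ true)
nested-head-literal (lit i p)      = i , p , inj₁ λ _ → id
nested-head-literal (disj i p φ _) = i , p , inj₁ λ x l → cong (_∨ eval φ x) l
nested-head-literal (conj i p φ _) = i , p , inj₂ λ x e → ∧-conicalˡ _ _ e

literal-without-gfun : (i : Fin (3 + k)) (p : Bool) → ∃[ x ] litVal i p x ≡ true × gfun x ≡ false
literal-without-gfun {k} zero true = raised zero , refl , gfun-raised-zero (suc k)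
literal-without-gfun (suc j) true  = false ∷ unit j , lookup-unit j , allV-unit j
literal-without-gfun i       false = zeros _ , cong not (Vec.lookup-replicate i false) , refl

gfun-without-literal : (i : Fin (3 + k)) (p : Bool) → ∃[ x ] gfun x ≡ true × litVal i p x ≡ false
gfun-without-literal {k} zero true = lowered zero , gfun-lowered-zero (2 + k) , refl
gfun-without-literal (suc j) true  =
  true ∷ counit j , trans (gfun-true∷ (counit j)) (anyV-counit j) , lookup-counit j
gfun-without-literal i       false = ones _ , refl , cong not (Vec.lookup-replicate i true)

gfun-not-lro : ¬ LRO (gfun {3 + k})
gfun-not-lro (inj₁ (_ , const)) = true≢false (trans (const (ones _)) (sym (const (zeros _))))
gfun-not-lro (inj₂ (_ , φ , eval≗)) with nested-head-literal φ
... | i , p , inj₁ lit⇒φ = let x , l , g = literal-without-gfun i p in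
  true≢false (trans (sym (lit⇒φ x l)) (trans (eval≗ x) g))
... | i , p , inj₂ φ⇒lit = let x , g , l = gfun-without-literal i p in
  true≢false (trans (sym (φ⇒lit x (trans (eval≗ x) g))) l)

lemma8 : (n : ℕ) → 3 ≤ n →
    Positive (gfun {n}) × Threshold (gfun {n}) × DependsOnAll (gfun {n}) ×
    ¬ LRO (gfun {n}) × SpecNumber (gfun {n}) (2 * n)
lemma8 (suc (suc (suc k))) (s≤s (s≤s (s≤s _))) =
  gfun-positive , gfun-threshold , gfun-depends , gfun-not-lro , gfun-specNumber
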